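{- $\mathbb{P}(K_3)$ does not satisfy transitivity: there exist $\Gamma,\Delta\subseteq For$ and $\alpha\in For$ such that $\Delta\vDash^{\mathbb{P}}_{K_3}\alpha$ and $\Gamma\vDash^{\mathbb{P}}_{K_3}\delta$ for all $\delta\in\Delta$, but $\Gamma\nvDash^{\mathbb{P}}_{K_3}\alpha$.
   Context: $For$ is the set of formulas built from a countable set $Prop$ of propositional letters with $\neg,\vee,\wedge,\rightarrow$. $K_3$ (Kleene) is given by the matrix with truth values $\{0,1/2,1\}$, designated set $\{1\}$, $f_\neg(x)=1-x$, $f_\vee=\max$, $f_\wedge=\min$, $f_\rightarrow(x,y)=\max\{1-x,y\}$; valuations are maps $Prop\to\{0,1/2,1\}$ extended via these functions. $\Gamma\vDash_{K_3}\alpha$ iff every valuation giving all members of $\Gamma$ value $1$ gives $\alpha$ value $1$; $\Gamma$ is $K_3$-consistent iff $\{\alpha:\Gamma\vDash_{K_3}\alpha\}\neq For$. $\Gamma\vDash^{\mathbb{P}}_{K_3}\alpha$ iff there exists a $K_3$-consistent $\Gamma'\subseteq\Gamma$ with $\Gamma'\vDash_{K_3}\alpha$. -}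

module Defs where

open import Data.Nat using (ℕ)
open import Data.Product using (Σ; ∃; _×_)
open import Relation.Binary.PropositionalEquality using (_≡_)
open import Relation.Nullary using (¬_)
open import Level using (0ℓ)
open import Relation.Unary using (Pred; _⊆_)

Prop : Set
Prop = ℕ

data For : Set where
  var  : Prop → For
  ¬'_  : For → For
  _∨'_ : For → For → For
  _∧'_ : For → For → For
  _⇒'_ : For → For → For

-- Truth values {0, 1/2, 1}
data V : Set where
  v0 vh v1 : V

f¬ : V → V
f¬ v0 = v1
f¬ vh = vh
f¬ v1 = v0

f∨ : V → V → V
f∨ v1 _  = v1
f∨ _  v1 = v1
f∨ vh _  = vh
f∨ _  vh = vh
f∨ v0 v0 = v0

f∧ : V → V → V
f∧ v0 _  = v0
f∧ _  v0 = v0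
f∧ vh _  = vh
f∧ _  vh = vh
f∧ v1 v1 = v1

f⇒ : V → V → V
f⇒ x y = f∨ (f¬ x) y

Valuation : Set
Valuation = Prop → V

⟦_⟧ : For → Valuation → V
⟦ var p ⟧ v = v p
⟦ ¬' a ⟧ v = f¬ (⟦ a ⟧ v)
⟦ a ∨' b ⟧ v = f∨ (⟦ a ⟧ v) (⟦ b ⟧ v)
⟦ a ∧' b ⟧ v = f∧ (⟦ a ⟧ v) (⟦ b ⟧ v)
⟦ a ⇒' b ⟧ v = f⇒ (⟦ a ⟧ v) (⟦ b ⟧ v)

FSet : Set₁
FSet = Pred For 0ℓ

_⊨K3_ : FSet → For → Set
Γ ⊨K3 α = (v : Valuation) → (∀ γ → Γ γ → ⟦ γ ⟧ v ≡ v1) → ⟦ α ⟧ v ≡ v1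

K3-consistent : FSet → Set
K3-consistent Γ = Σ For (λ β → ¬ (Γ ⊨K3 β))

_⊨ᴾK3_ : FSet → For → Set₁
Γ ⊨ᴾK3 α = Σ FSet (λ Γ' → (Γ' ⊆ Γ) × K3-consistent Γ' × (Γ' ⊨K3 α))

-- Take Γ = {p, ¬p}, Δ = {p, ¬p ∨ q} and α = q.  Disjunctive syllogism holds in K₃, so
-- Δ ⊨ q, and Δ is satisfied by the all-true valuation.  Each member of Δ follows from a
-- satisfiable singleton subset of Γ.  But a consistent set never entails a letter it does
-- not mention: resetting that letter to 0 preserves the premises and falsifies the letter,
-- so entailing it would leave the set without models, hence trivial.
module Submission where

open import Defs
open import Data.Nat using (_≟_)
open import Data.Product using (Σ; _×_; _,_)
open import Data.Sum using (inj₁; inj₂)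
open import Data.Empty using (⊥-elim)
open import Relation.Nullary using (¬_; yes; no)
open import Relation.Unary using (｛_｝; _∪_)
open import Relation.Binary.PropositionalEquality using (_≡_; _≢_; refl; sym; trans; cong; cong₂)

Satisfies : Valuation → FSet → Set
Satisfies v Γ = ∀ γ → Γ γ → ⟦ γ ⟧ v ≡ v1

satisfies-｛｝ : ∀ {v α} → ⟦ α ⟧ v ≡ v1 → Satisfies v ｛ α ｝
satisfies-｛｝ αv≡1 _ refl = αv≡1

countermodel⇒consistent : ∀ {Γ} v α → Satisfies v Γ → ⟦ α ⟧ v ≢ v1 → K3-consistent Γ
countermodel⇒consistent v α v⊨Γ αv≢1 = α , λ Γ⊨α → αv≢1 (Γ⊨α v v⊨Γ)

v0≢v1 : v0 ≢ v1
v0≢v1 ()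

Fresh : Prop → For → Set
Fresh n (var m)  = m ≢ n
Fresh n (¬' α)   = Fresh n α
Fresh n (α ∨' β) = Fresh n α × Fresh n β
Fresh n (α ∧' β) = Fresh n α × Fresh n β
Fresh n (α ⇒' β) = Fresh n α × Fresh n β

_[_≔_] : Valuation → Prop → V → Valuation
(v [ n ≔ x ]) m with m ≟ n
... | yes _ = x
... | no  _ = v m

⟦⟧-update-fresh : ∀ {n x} v α → Fresh n α → ⟦ α ⟧ (v [ n ≔ x ]) ≡ ⟦ α ⟧ v
⟦⟧-update-fresh {n} v (var m) m≢n with m ≟ n
... | yes m≡n = ⊥-elim (m≢n m≡n)
... | no  _   = refl
⟦⟧-update-fresh v (¬' α) fr = cong f¬ (⟦⟧-update-fresh v α fr)
⟦⟧-update-fresh v (α ∨' β) (frα , frβ) =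
  cong₂ f∨ (⟦⟧-update-fresh v α frα) (⟦⟧-update-fresh v β frβ)
⟦⟧-update-fresh v (α ∧' β) (frα , frβ) =
  cong₂ f∧ (⟦⟧-update-fresh v α frα) (⟦⟧-update-fresh v β frβ)
⟦⟧-update-fresh v (α ⇒' β) (frα , frβ) =
  cong₂ f⇒ (⟦⟧-update-fresh v α frα) (⟦⟧-update-fresh v β frβ)

⟦var⟧-update : ∀ n x v → ⟦ var n ⟧ (v [ n ≔ x ]) ≡ x
⟦var⟧-update n x v with n ≟ n
... | yes _   = refl
... | no  n≢n = ⊥-elim (n≢n refl)

consistent⇒⊭-fresh-var : ∀ {Γ n} → K3-consistent Γ → (∀ γ → Γ γ → Fresh n γ) →
                         ¬ (Γ ⊨K3 var n)
consistent⇒⊭-fresh-var {Γ} {n} (β , Γ⊭β) fresh Γ⊨n = Γ⊭β Γ-has-no-model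
  where
  reset : ∀ v → Satisfies v Γ → Satisfies (v [ n ≔ v0 ]) Γ
  reset v v⊨Γ γ γ∈Γ = trans (⟦⟧-update-fresh v γ (fresh γ γ∈Γ)) (v⊨Γ γ γ∈Γ)

  Γ-has-no-model : Γ ⊨K3 β
  Γ-has-no-model v v⊨Γ =
    ⊥-elim (v0≢v1 (trans (sym (⟦var⟧-update n v0 v)) (Γ⊨n (v [ n ≔ v0 ]) (reset v v⊨Γ))))

disjunctive-syllogism : ∀ α β v → ⟦ α ⟧ v ≡ v1 → ⟦ (¬' α) ∨' β ⟧ v ≡ v1 → ⟦ β ⟧ v ≡ v1
disjunctive-syllogism α β v αv≡1 ¬α∨βv≡1 rewrite αv≡1 with ⟦ β ⟧ v
... | v1 = refl

∨-introˡ : ∀ α β v → ⟦ α ⟧ v ≡ v1 → ⟦ α ∨' β ⟧ v ≡ v1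
∨-introˡ α β v αv≡1 rewrite αv≡1 = refl

p q : For
p = var 0
q = var 1

Γ₀ Δ₀ : FSet
Γ₀ = ｛ p ｝ ∪ ｛ ¬' p ｝
Δ₀ = ｛ p ｝ ∪ ｛ (¬' p) ∨' q ｝

all-true all-false : Valuation
all-true  _ = v1
all-false _ = v0

Δ₀⊨q : Δ₀ ⊨K3 q
Δ₀⊨q v v⊨Δ₀ = disjunctive-syllogism p q v (v⊨Δ₀ p (inj₁ refl)) (v⊨Δ₀ _ (inj₂ refl))

Δ₀-consistent : K3-consistent Δ₀
Δ₀-consistent = countermodel⇒consistent all-true (¬' p) all-true⊨Δ₀ v0≢v1
  where
  all-true⊨Δ₀ : Satisfies all-true Δ₀
  all-true⊨Δ₀ _ (inj₁ refl) = refl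
  all-true⊨Δ₀ _ (inj₂ refl) = refl

Γ₀⊨ᴾΔ₀ : ∀ δ → Δ₀ δ → Γ₀ ⊨ᴾK3 δ
Γ₀⊨ᴾΔ₀ _ (inj₁ refl) =
  ｛ p ｝ , inj₁ , countermodel⇒consistent (all-false [ 0 ≔ v1 ]) q (satisfies-｛｝ refl) v0≢v1 ,
  λ v v⊨p → v⊨p p refl
Γ₀⊨ᴾΔ₀ _ (inj₂ refl) =
  ｛ ¬' p ｝ , inj₂ , countermodel⇒consistent all-false p (satisfies-｛｝ refl) v0≢v1 ,
  λ v v⊨¬p → ∨-introˡ (¬' p) q v (v⊨¬p (¬' p) refl)

q-fresh-in-Γ₀ : ∀ γ → Γ₀ γ → Fresh 1 γ
q-fresh-in-Γ₀ _ (inj₁ refl) ()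
q-fresh-in-Γ₀ _ (inj₂ refl) ()

proposition24 : Σ FSet (λ Γ → Σ FSet (λ Δ → Σ For (λ α →
                  (Δ ⊨ᴾK3 α) × ((∀ δ → Δ δ → Γ ⊨ᴾK3 δ) × ¬ (Γ ⊨ᴾK3 α)))))
proposition24 =
  Γ₀ , Δ₀ , q , (Δ₀ , (λ δ∈Δ₀ → δ∈Δ₀) , Δ₀-consistent , Δ₀⊨q) , Γ₀⊨ᴾΔ₀ ,
  λ (Γ' , Γ'⊆Γ₀ , Γ'-consistent , Γ'⊨q) →
    consistent⇒⊭-fresh-var Γ'-consistent (λ γ γ∈Γ' → q-fresh-in-Γ₀ γ (Γ'⊆Γ₀ γ∈Γ')) Γ'⊨q
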